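{- Let $\alpha\colon\mathbb T\to\mathbb S$ be a guarded monad morphism between guarded pre-iterative monads $\mathbb T,\mathbb S$, where $\mathbb S$ is guarded iterative. Then $\alpha$ is iteration-preserving, i.e. $\alpha\circ f^\dagger=(\alpha\circ f)^\dagger$ for every $f\colon X\to_{\mathrm{inr}}T(Y+X)$.
   Context: Monads on a category with finite coproducts, with unit $\eta$ and Kleisli lifting $(-)^*$. A guarded monad has a relation $f\colon X\to_\sigma TY$ ($\sigma$ a summand of $Y$) closed under (trv) $T(\mathrm{inl})\circ f\colon X\to_{\mathrm{inr}}T(Y+Z)$; (par) $f\colon X\to_\sigma TZ$, $g\colon Y\to_\sigma TZ$ imply $[f,g]\colon X+Y\to_\sigma TZ$; (cmp) $f\colon X\to_{\mathrm{inr}}T(Y+Z)$, $g\colon Y\to_\sigma TV$, $h\colon Z\to TV$ imply $[g,h]^*\circ f\colon X\to_\sigma TV$. Guarded pre-iterative: operator assigning to every $f\colon X\to_{\mathrm{inr}}T(Y+X)$ some $f^\dagger\colon X\to TY$ with $f^\dagger=[\eta,f^\dagger]^*\circ f$; guarded iterative: such solutions are unique. A guarded monad morphism is a monad morphism with $f\colon X\to_\sigma TY\Rightarrow\alpha\circ f\colon X\to_\sigma SY$. -}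

module Defs where

open import Level using (Level; _⊔_; suc)
open import Relation.Binary using (IsEquivalence)

record Category (o ℓ e : Level) : Set (suc (o ⊔ ℓ ⊔ e)) where
  infixr 9 _∘_
  infix  4 _≈_
  infix  5 _⇒_
  field
    Obj   : Set o
    _⇒_   : Obj → Obj → Set ℓ
    _≈_   : ∀ {A B} → A ⇒ B → A ⇒ B → Set e
    id    : ∀ {A} → A ⇒ A
    _∘_   : ∀ {A B C} → B ⇒ C → A ⇒ B → A ⇒ C
    ≈-equiv   : ∀ {A B} → IsEquivalence (_≈_ {A} {B})
    ∘-resp-≈  : ∀ {A B C} {f h : B ⇒ C} {g i : A ⇒ B} → f ≈ h → g ≈ i → f ∘ g ≈ h ∘ i
    identityˡ : ∀ {A B} {f : A ⇒ B} → id ∘ f ≈ f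
    identityʳ : ∀ {A B} {f : A ⇒ B} → f ∘ id ≈ f
    assoc     : ∀ {A B C D} {f : A ⇒ B} {g : B ⇒ C} {h : C ⇒ D} →
                (h ∘ g) ∘ f ≈ h ∘ (g ∘ f)

record Coproducts {o ℓ e} (C : Category o ℓ e) : Set (o ⊔ ℓ ⊔ e) where
  open Category C
  infixr 6 _+_
  field
    _+_   : Obj → Obj → Obj
    inl   : ∀ {A B} → A ⇒ A + B
    inr   : ∀ {A B} → B ⇒ A + B
    [_,_] : ∀ {A B X} → A ⇒ X → B ⇒ X → A + B ⇒ X
    inlβ  : ∀ {A B X} {f : A ⇒ X} {g : B ⇒ X} → [ f , g ] ∘ inl ≈ f
    inrβ  : ∀ {A B X} {f : A ⇒ X} {g : B ⇒ X} → [ f , g ] ∘ inr ≈ g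
    +-unique : ∀ {A B X} {f : A ⇒ X} {g : B ⇒ X} {h : A + B ⇒ X} →
               h ∘ inl ≈ f → h ∘ inr ≈ g → h ≈ [ f , g ]

record FinCoproducts {o ℓ e} (C : Category o ℓ e) : Set (o ⊔ ℓ ⊔ e) where
  open Category C
  field
    ⊥        : Obj
    ¡        : ∀ {A} → ⊥ ⇒ A
    ¡-unique : ∀ {A} (f : ⊥ ⇒ A) → f ≈ ¡
    coproducts : Coproducts C
  open Coproducts coproducts public

module _ {o ℓ e} (C : Category o ℓ e) where
  open Category C

  record Monad : Set (o ⊔ ℓ ⊔ e) where
    field
      T     : Obj → Obj
      η     : ∀ {A} → A ⇒ T A
      _*    : ∀ {A B} → A ⇒ T B → T A ⇒ T B
      *-resp-≈ : ∀ {A B} {f g : A ⇒ T B} → f ≈ g → f * ≈ g *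
      η*    : ∀ {A} → η {A} * ≈ id
      *η    : ∀ {A B} {f : A ⇒ T B} → f * ∘ η ≈ f
      **    : ∀ {A B D} {f : A ⇒ T B} {g : B ⇒ T D} → (g * ∘ f) * ≈ g * ∘ f *
    Tₘ : ∀ {A B} → A ⇒ B → T A ⇒ T B
    Tₘ f = (η ∘ f) *

  record MonadMorphism (𝕋 𝕊 : Monad) : Set (o ⊔ ℓ ⊔ e) where
    private
      module T = Monad 𝕋
      module S = Monad 𝕊
    field
      α     : ∀ {A} → T.T A ⇒ S.T A
      α-η   : ∀ {A} → α ∘ T.η {A} ≈ S.η
      α-*   : ∀ {A B} {f : A ⇒ T.T B} → α ∘ (f T.*) ≈ ((α ∘ f) S.*) ∘ α

module _ {o ℓ e} {C : Category o ℓ e} (CP : FinCoproducts C) where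
  open Category C
  open FinCoproducts CP

  record Summand (Y : Obj) : Set (o ⊔ ℓ ⊔ e) where
    field
      Sub  : Obj
      Comp : Obj
      σ    : Sub ⇒ Y
      κ    : Comp ⇒ Y
      inv  : Y ⇒ Comp + Sub
      isoˡ : [ κ , σ ] ∘ inv ≈ id
      isoʳ : inv ∘ [ κ , σ ] ≈ id

  inrS : ∀ {Y Z} → Summand (Y + Z)
  inrS {Y} {Z} = record
    { Sub = Z ; Comp = Y ; σ = inr ; κ = inl ; inv = id
    ; isoˡ = iso1 ; isoʳ = iso2 }
    where
      open IsEquivalence (≈-equiv {Y + Z} {Y + Z})
      uid : id ≈ [ inl , inr ]
      uid = +-unique identityˡ identityˡ
      iso1 : [ inl , inr ] ∘ id ≈ id
      iso1 = trans identityʳ (sym uid)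
      iso2 : id ∘ [ inl , inr ] ≈ id
      iso2 = trans identityˡ (sym uid)

  -- A guarded monad: a monad with a guardedness relation f : X →σ TY.
  record GuardedMonad (g : Level) : Set (o ⊔ ℓ ⊔ e ⊔ suc g) where
    field
      monad : Monad C
    open Monad monad public
    field
      Guarded : ∀ {X Y} → Summand Y → X ⇒ T Y → Set g
      Guarded-resp-≈ : ∀ {X Y} {s : Summand Y} {f f′ : X ⇒ T Y} →
                       f ≈ f′ → Guarded s f → Guarded s f′
      trv : ∀ {X Y Z} (f : X ⇒ T Y) → Guarded (inrS {Y} {Z}) (Tₘ inl ∘ f)
      par : ∀ {X Y Z} {s : Summand Z} {f : X ⇒ T Z} {h : Y ⇒ T Z} →
            Guarded s f → Guarded s h → Guarded s [ f , h ]
      cmp : ∀ {X Y Z V} {s : Summand V} {f : X ⇒ T (Y + Z)}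
              {h : Y ⇒ T V} {k : Z ⇒ T V} →
            Guarded inrS f → Guarded s h → Guarded s ([ h , k ] * ∘ f)

  record GuardedPreIterative (g : Level) : Set (o ⊔ ℓ ⊔ e ⊔ suc g) where
    field
      guardedMonad : GuardedMonad g
    open GuardedMonad guardedMonad public
    field
      _† : ∀ {X Y} (f : X ⇒ T (Y + X)) → Guarded inrS f → X ⇒ T Y
      †-fix : ∀ {X Y} (f : X ⇒ T (Y + X)) (p : Guarded inrS f) →
              (f †) p ≈ [ η , (f †) p ] * ∘ f

  IsGuardedIterative : ∀ {g} → GuardedPreIterative g → Set (o ⊔ ℓ ⊔ e ⊔ g)
  IsGuardedIterative 𝕋 =
    ∀ {X Y} (f : X ⇒ T (Y + X)) (p : Guarded inrS f) (h : X ⇒ T Y) →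
    h ≈ [ η , h ] * ∘ f → h ≈ (f †) p
    where open GuardedPreIterative 𝕋

  record GuardedMonadMorphism {g g′ : Level}
      (𝕋 : GuardedMonad g) (𝕊 : GuardedMonad g′) : Set (o ⊔ ℓ ⊔ e ⊔ g ⊔ g′) where
    private
      module T = GuardedMonad 𝕋
      module S = GuardedMonad 𝕊
    field
      morphism : MonadMorphism C T.monad S.monad
    open MonadMorphism morphism public
    field
      preserves-guarded : ∀ {X Y} {s : Summand Y} {f : X ⇒ T.T Y} →
                          T.Guarded s f → S.Guarded s (α ∘ f)

-- Any monad morphism maps solutions of x = [ η , x ] * ∘ f to solutions of
-- x = [ η , x ] * ∘ (α ∘ f), because α ∘ [ η , h ] * = [ η , α ∘ h ] * ∘ α. Hence α ∘ f † solves the equation of α ∘ f,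
-- which is guarded since α preserves guardedness, and uniqueness of solutions
-- in 𝕊 identifies it with (α ∘ f) †.
module Submission where

open import Level using (Level)
open import Relation.Binary.Bundles using (Setoid)
import Relation.Binary.Reasoning.Setoid as SetoidReasoning
open import Defs

module _ {o ℓ e} {C : Category o ℓ e} (CP : FinCoproducts C)
         {𝕋 𝕊 : Monad C} (A : MonadMorphism C 𝕋 𝕊) where
  open Category C
  open FinCoproducts CP
  open MonadMorphism A
  private
    module T = Monad 𝕋
    module S = Monad 𝕊

    hom : Obj → Obj → Setoid ℓ e
    hom X Y = record { Carrier = X ⇒ Y ; _≈_ = _≈_ ; isEquivalence = ≈-equiv }

    refl : ∀ {X Y} {f : X ⇒ Y} → f ≈ f
    refl {X} {Y} = Setoid.refl (hom X Y)

    sym : ∀ {X Y} {f g : X ⇒ Y} → f ≈ g → g ≈ f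
    sym {X} {Y} = Setoid.sym (hom X Y)

  α-copair-η : ∀ {X Y} (h : X ⇒ T.T Y) → α ∘ [ T.η , h ] ≈ [ S.η , α ∘ h ]
  α-copair-η {X} {Y} h = +-unique on-inl on-inr
    where
    on-inl : (α ∘ [ T.η , h ]) ∘ inl ≈ S.η
    on-inl = begin
      (α ∘ [ T.η , h ]) ∘ inl ≈⟨ assoc ⟩
      α ∘ [ T.η , h ] ∘ inl   ≈⟨ ∘-resp-≈ refl inlβ ⟩
      α ∘ T.η                 ≈⟨ α-η ⟩
      S.η                     ∎
      where open SetoidReasoning (hom Y (S.T Y))

    on-inr : (α ∘ [ T.η , h ]) ∘ inr ≈ α ∘ h
    on-inr = begin
      (α ∘ [ T.η , h ]) ∘ inr ≈⟨ assoc ⟩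
      α ∘ [ T.η , h ] ∘ inr   ≈⟨ ∘-resp-≈ refl inrβ ⟩
      α ∘ h                   ∎
      where open SetoidReasoning (hom X (S.T Y))

  α-preserves-solution : ∀ {X Y} (f : X ⇒ T.T (Y + X)) (h : X ⇒ T.T Y) →
                         h ≈ [ T.η , h ] T.* ∘ f →
                         α ∘ h ≈ [ S.η , α ∘ h ] S.* ∘ (α ∘ f)
  α-preserves-solution {X} {Y} f h h-solves = begin
    α ∘ h                               ≈⟨ ∘-resp-≈ refl h-solves ⟩
    α ∘ ([ T.η , h ] T.* ∘ f)           ≈⟨ sym assoc ⟩
    (α ∘ [ T.η , h ] T.*) ∘ f           ≈⟨ ∘-resp-≈ α-* refl ⟩
    ((α ∘ [ T.η , h ]) S.* ∘ α) ∘ f     ≈⟨ assoc ⟩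
    (α ∘ [ T.η , h ]) S.* ∘ (α ∘ f)     ≈⟨ ∘-resp-≈ (S.*-resp-≈ (α-copair-η h)) refl ⟩
    [ S.η , α ∘ h ] S.* ∘ (α ∘ f)       ∎
    where open SetoidReasoning (hom X (S.T Y))

lemma3p10 : ∀ {o ℓ e g g′ : Level} {C : Category o ℓ e} (CP : FinCoproducts C)
    (𝕋 : GuardedPreIterative CP g) (𝕊 : GuardedPreIterative CP g′) →
    IsGuardedIterative CP 𝕊 →
    (A : GuardedMonadMorphism CP (GuardedPreIterative.guardedMonad 𝕋)
    (GuardedPreIterative.guardedMonad 𝕊)) →
    ∀ {X Y} (f : Category._⇒_ C X (Monad.T (GuardedPreIterative.monad 𝕋) (FinCoproducts._+_ CP Y X)))
    (p : GuardedPreIterative.Guarded 𝕋 (inrS CP) f) →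
    Category._≈_ C
    (Category._∘_ C (GuardedMonadMorphism.α A) (GuardedPreIterative._† 𝕋 f p))
    (GuardedPreIterative._† 𝕊 (Category._∘_ C (GuardedMonadMorphism.α A) f)
    (GuardedMonadMorphism.preserves-guarded A p))
lemma3p10 {C = C} CP 𝕋 𝕊 unique A f p =
  unique (α ∘ f) (preserves-guarded p) (α ∘ (f T.†) p)
         (α-preserves-solution CP morphism f ((f T.†) p) (T.†-fix f p))
  where
    open Category C
    module T = GuardedPreIterative 𝕋
    open GuardedMonadMorphism A
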